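{- Let $P,Q$ be finite posets, and write $\phi(P ; x, y, z) = \sum_{i,j,k} p_{i, j, k} x^i y^j z^k$ and $\phi(Q ; x, y, z) = \sum_{i,j,k} q_{i, j, k} x^i y^j z^k$. Then \[ \phi(P \times Q ; x, y, z) = \sum_{i,j,k} q_{i, j, k}\, \phi(P ; x^i, y^j, z^k) = \sum_{i,j,k} p_{i, j, k}\, \phi(Q ; x^i, y^j, z^k). \]
   Context: For a finite poset $P$ and $u\in P$, let $V(u)=\{v\in P: u\le v\}$, $\Lambda(u)=\{v\in P: v\le u\}$, and for $u\le v$ let $[u,v]=\{w\in P: u\le w\le v\}$. Define \[\phi(P;x,y,z)=\sum_{u\le v} x^{|\Lambda(v)|}\,y^{|V(u)|}\,z^{|[u,v]|},\] the sum over all pairs $(u,v)$ of elements of $P$ with $u\le v$ (equivalently, $\phi(P;x,y,z)$ is the coefficient of $st$ in the generalized interval polynomial of $P$). The Cartesian product $P\times Q$ is the poset on the set $P\times Q$ with $(u_P,u_Q)\le(v_P,v_Q)$ iff $u_P\le v_P$ and $u_Q\le v_Q$. -}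

module Defs where

open import Level using (Level; 0ℓ)
open import Data.Nat as ℕ using (ℕ; zero; suc)
open import Data.Bool using (Bool)
open import Data.Product using (_×_; _,_; proj₁; proj₂)
open import Data.Product.Properties using (≡-dec)
open import Data.List using (List; _∷_; []; length; filter; map; cartesianProduct; upTo; foldr)
open import Data.List.Membership.Propositional using (_∈_)
open import Data.List.Membership.Propositional.Properties using (∈-cartesianProduct⁺)
open import Data.List.Relation.Unary.Unique.Propositional using (Unique)
open import Data.List.Relation.Unary.Unique.Propositional.Properties using (cartesianProduct⁺)
open import Relation.Binary using (Rel; Decidable; IsPartialOrder; IsPreorder)
open import Relation.Binary.PropositionalEquality using (_≡_; refl; cong₂; isEquivalence; resp₂)
open import Relation.Nullary using (Dec; yes; no)
open import Relation.Nullary.Decidable using (_×-dec_)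
open import Algebra.Bundles using (CommutativeSemiring)
import Algebra.Definitions.RawSemiring as RS

record FinPoset : Set₁ where
  field
    Carrier        : Set
    elems          : List Carrier
    elems-unique   : Unique elems
    elems-complete : ∀ x → x ∈ elems
    _≤_            : Rel Carrier 0ℓ
    _≤?_           : Decidable _≤_
    isPartialOrder : IsPartialOrder _≡_ _≤_

  count : {p : Level} {Pr : Carrier → Set p} → (∀ w → Dec (Pr w)) → ℕ
  count d = length (filter d elems)

  ∣Λ∣ : Carrier → ℕ
  ∣Λ∣ v = count (λ w → w ≤? v)

  ∣V∣ : Carrier → ℕ
  ∣V∣ u = count (λ w → u ≤? w)

  ∣[_,_]∣ : Carrier → Carrier → ℕ
  ∣[ u , v ]∣ = count (λ w → (u ≤? w) ×-dec (w ≤? v))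

  comparablePairs : List (Carrier × Carrier)
  comparablePairs = filter (λ uv → proj₁ uv ≤? proj₂ uv) (cartesianProduct elems elems)

  exps : Carrier × Carrier → ℕ × ℕ × ℕ
  exps (u , v) = ∣Λ∣ v , ∣V∣ u , ∣[ u , v ]∣

  coeff : ℕ → ℕ → ℕ → ℕ
  coeff i j k = length (filter (λ uv → ≡-dec ℕ._≟_ (≡-dec ℕ._≟_ ℕ._≟_) (exps uv) (i , j , k))
                               comparablePairs)

open FinPoset public

_×ᴾ_ : FinPoset → FinPoset → FinPoset
P ×ᴾ Q = record
  { Carrier        = Carrier P × Carrier Q
  ; elems          = cartesianProduct (elems P) (elems Q)
  ; elems-unique   = cartesianProduct⁺ (elems-unique P) (elems-unique Q)
  ; elems-complete = λ { (a , b) → ∈-cartesianProduct⁺ (elems-complete P a) (elems-complete Q b) }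
  ; _≤_            = λ x y → (_≤_ P (proj₁ x) (proj₁ y)) × (_≤_ Q (proj₂ x) (proj₂ y))
  ; _≤?_           = λ x y → (_≤?_ P (proj₁ x) (proj₁ y)) ×-dec (_≤?_ Q (proj₂ x) (proj₂ y))
  ; isPartialOrder = record
      { isPreorder = record
          { isEquivalence = isEquivalence
          ; reflexive     = λ { refl → reflP refl , reflQ refl }
          ; trans         = λ { (a , b) (c , d) → transP a c , transQ b d }
          }
      ; antisym = λ { (a , b) (c , d) → cong₂ _,_ (antiP a c) (antiQ b d) }
      }
  }
  where
  module PP = IsPartialOrder (isPartialOrder P)
  module QQ = IsPartialOrder (isPartialOrder Q)
  reflP = PP.reflexive
  reflQ = QQ.reflexive
  transP = PP.trans
  transQ = QQ.trans
  antiP = PP.antisym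
  antiQ = QQ.antisym

-- Since R is arbitrary (e.g. R = ℤ[x,y,z]), identities of these
-- evaluations for all R, x, y, z are exactly polynomial identities.

module Eval {c ℓ : Level} (R : CommutativeSemiring c ℓ) where
  open CommutativeSemiring R renaming (Carrier to R₀)
  open RS rawSemiring using (_^_) renaming (_×_ to _·_) public

  Σ : {A : Set} → (A → R₀) → List A → R₀
  Σ f = foldr (λ a acc → f a + acc) 0#

  φ : FinPoset → R₀ → R₀ → R₀ → R₀
  φ P x y z = Σ (λ uv → (x ^ ∣Λ∣ P (proj₂ uv)) * (y ^ ∣V∣ P (proj₁ uv)) * (z ^ ∣[_,_]∣ P (proj₁ uv) (proj₂ uv)))
                (comparablePairs P)

  -- Σ_{i,j,k} p_{i,j,k} f(i,j,k), with i,j,k ranging over 0..|P|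
  -- (all exponents of φ(P) are ≤ |P|, so this covers every nonzero coefficient)
  ΣCoeff : FinPoset → (ℕ → ℕ → ℕ → R₀) → R₀
  ΣCoeff P f = Σ (λ i → Σ (λ j → Σ (λ k → coeff P i j k · f i j k) rng) rng) rng
    where rng = upTo (suc (length (elems P)))

module Submission where

-- Componentwise order makes the down-set, up-set and interval of (a,b) ≤ (c,d) in P × Q the
-- products of those of a ≤ c in P and of b ≤ d in Q, so their sizes multiply and the monomial
-- of ((a,b),(c,d)) is the monomial of (a,c) in φ(P) evaluated at x^|Λ(d)|, y^|V(b)|, z^|[b,d]|.
-- Summing over the comparable pairs (b,d) of Q, which ΣCoeff Q does after grouping them by
-- their exponent triple, gives the first identity; exchanging P and Q gives the second.

open import Defs
open import Level using (Level)
open import Function using (_∘_)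
open import Data.Bool using (Bool; true; false; _∧_)
open import Data.Bool.Properties using (∧-commutativeMonoid)
open import Data.Nat as ℕ using (ℕ; zero; suc; s≤s)
import Data.Nat.Properties as ℕₚ
open import Data.Product using (_×_; _,_; proj₁; proj₂)
open import Data.Product.Properties using (≡-dec)
open import Relation.Binary using (DecidableEquality)
open import Data.List using (List; []; _∷_; _++_; map; filter; cartesianProduct; length; upTo; applyUpTo)
open import Data.List.Properties using (filter-++; length-++; length-map; length-filter; map-upTo)
open import Relation.Nullary using (does; yes; no)
open import Relation.Nullary.Decidable using (_×-dec_)
open import Relation.Unary using (Pred; Decidable)
open import Relation.Binary.PropositionalEquality as ≡ using (_≡_)
import Algebra.Properties.CommutativeSemigroup as CommutativeSemigroupProperties
open import Algebra.Bundles using (CommutativeMonoid; CommutativeSemiring)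

private
  variable
    a b p q r : Level
    A : Set a
    B : Set b

module _ {P : Pred A p} (P? : Decidable P) where

  filter-map : (f : B → A) (xs : List B) → filter P? (map f xs) ≡ map f (filter (P? ∘ f) xs)
  filter-map f [] = ≡.refl
  filter-map f (x ∷ xs) with does (P? (f x))
  ... | true  = ≡.cong (f x ∷_) (filter-map f xs)
  ... | false = filter-map f xs

  filter-reject-all : (∀ x → does (P? x) ≡ false) → (xs : List A) → filter P? xs ≡ []
  filter-reject-all rejects [] = ≡.refl
  filter-reject-all rejects (x ∷ xs) with does (P? x) | rejects x
  ... | false | ≡.refl = filter-reject-all rejects xs

module _ {P : Pred A p} {Q : Pred A q} (P? : Decidable P) (Q? : Decidable Q) where

  filter-does-cong : (∀ x → does (P? x) ≡ does (Q? x)) → (xs : List A) → filter P? xs ≡ filter Q? xs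
  filter-does-cong same [] = ≡.refl
  filter-does-cong same (x ∷ xs) with does (P? x) | does (Q? x) | same x
  ... | true  | .true  | ≡.refl = ≡.cong (x ∷_) (filter-does-cong same xs)
  ... | false | .false | ≡.refl = filter-does-cong same xs

length-cartesianProduct : (xs : List A) (ys : List B) →
                          length (cartesianProduct xs ys) ≡ length xs ℕ.* length ys
length-cartesianProduct []       ys = ≡.refl
length-cartesianProduct (x ∷ xs) ys =
  ≡.trans (length-++ (map (x ,_) ys))
          (≡.cong₂ ℕ._+_ (length-map (x ,_) ys) (length-cartesianProduct xs ys))

module _ {P : Pred A p} {Q : Pred B q} {PQ : Pred (A × B) r}
         (P? : Decidable P) (Q? : Decidable Q) (PQ? : Decidable PQ)
         (does-PQ? : ∀ x y → does (PQ? (x , y)) ≡ does (P? x) ∧ does (Q? y)) where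

  private
    filter-row-accept : ∀ {x} → does (P? x) ≡ true → (ys : List B) →
                        filter PQ? (map (x ,_) ys) ≡ map (x ,_) (filter Q? ys)
    filter-row-accept {x} accept ys =
      ≡.trans (filter-map PQ? (x ,_) ys)
            (≡.cong (map (x ,_)) (filter-does-cong (PQ? ∘ (x ,_)) Q?
                                  (λ y → ≡.trans (does-PQ? x y) (≡.cong (_∧ does (Q? y)) accept)) ys))

    filter-row-reject : ∀ {x} → does (P? x) ≡ false → (ys : List B) →
                        filter PQ? (map (x ,_) ys) ≡ []
    filter-row-reject {x} reject ys =
      ≡.trans (filter-map PQ? (x ,_) ys)
            (≡.cong (map (x ,_)) (filter-reject-all (PQ? ∘ (x ,_))
                                  (λ y → ≡.trans (does-PQ? x y) (≡.cong (_∧ does (Q? y)) reject)) ys))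

  filter-cartesianProduct : (xs : List A) (ys : List B) →
    filter PQ? (cartesianProduct xs ys) ≡ cartesianProduct (filter P? xs) (filter Q? ys)
  filter-cartesianProduct []       ys = ≡.refl
  filter-cartesianProduct (x ∷ xs) ys with does (P? x) in eq
  ... | true  = ≡.trans (filter-++ PQ? (map (x ,_) ys) (cartesianProduct xs ys))
                      (≡.cong₂ _++_ (filter-row-accept eq ys) (filter-cartesianProduct xs ys))
  ... | false = ≡.trans (filter-++ PQ? (map (x ,_) ys) (cartesianProduct xs ys))
                      (≡.cong₂ _++_ (filter-row-reject eq ys) (filter-cartesianProduct xs ys))

  length-filter-cartesianProduct : (xs : List A) (ys : List B) →
    length (filter PQ? (cartesianProduct xs ys)) ≡ length (filter P? xs) ℕ.* length (filter Q? ys)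
  length-filter-cartesianProduct xs ys =
    ≡.trans (≡.cong length (filter-cartesianProduct xs ys))
            (length-cartesianProduct (filter P? xs) (filter Q? ys))

does-≡-dec-× : (_≟ᴬ_ : DecidableEquality A) (_≟ᴮ_ : DecidableEquality B) (x x′ : A) (y y′ : B) →
               does (≡-dec _≟ᴬ_ _≟ᴮ_ (x , y) (x′ , y′)) ≡ does (x ≟ᴬ x′) ∧ does (y ≟ᴮ y′)
does-≡-dec-× _≟ᴬ_ _≟ᴮ_ x x′ y y′ with x ≟ᴬ x′
... | yes ≡.refl = ≡.refl
... | no _       = ≡.refl

does-≟³ : ∀ e₁ e₂ e₃ i j k →
          does (≡-dec ℕ._≟_ (≡-dec ℕ._≟_ ℕ._≟_) (e₁ , e₂ , e₃) (i , j , k))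
          ≡ does (e₁ ℕ.≟ i) ∧ (does (e₂ ℕ.≟ j) ∧ does (e₃ ℕ.≟ k))
does-≟³ e₁ e₂ e₃ i j k =
  ≡.trans (does-≡-dec-× ℕ._≟_ (≡-dec ℕ._≟_ ℕ._≟_) e₁ i (e₂ , e₃) (j , k))
          (≡.cong (does (e₁ ℕ.≟ i) ∧_) (does-≡-dec-× ℕ._≟_ ℕ._≟_ e₂ j e₃ k))

module _ (P Q : FinPoset) where

  ∣Λ∣-×ᴾ : ∀ c d → ∣Λ∣ (P ×ᴾ Q) (c , d) ≡ ∣Λ∣ P c ℕ.* ∣Λ∣ Q d
  ∣Λ∣-×ᴾ c d = length-filter-cartesianProduct (λ w → _≤?_ P w c) (λ w → _≤?_ Q w d) _
                 (λ _ _ → ≡.refl) (elems P) (elems Q)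

  ∣V∣-×ᴾ : ∀ a b → ∣V∣ (P ×ᴾ Q) (a , b) ≡ ∣V∣ P a ℕ.* ∣V∣ Q b
  ∣V∣-×ᴾ a b = length-filter-cartesianProduct (_≤?_ P a) (_≤?_ Q b) _
                 (λ _ _ → ≡.refl) (elems P) (elems Q)

  ∣[]∣-×ᴾ : ∀ a b c d → ∣[_,_]∣ (P ×ᴾ Q) (a , b) (c , d) ≡ ∣[_,_]∣ P a c ℕ.* ∣[_,_]∣ Q b d
  ∣[]∣-×ᴾ a b c d =
    length-filter-cartesianProduct (λ w → _≤?_ P a w ×-dec _≤?_ P w c) (λ w → _≤?_ Q b w ×-dec _≤?_ Q w d) _
      (λ u v → interchange (does (_≤?_ P a u)) (does (_≤?_ Q b v)) (does (_≤?_ P u c)) (does (_≤?_ Q v d)))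
      (elems P) (elems Q)
    where open CommutativeSemigroupProperties (CommutativeMonoid.commutativeSemigroup ∧-commutativeMonoid)

module _ {c ℓ : Level} (R : CommutativeSemiring c ℓ) where

  open CommutativeSemiring R renaming (Carrier to R₀)
  open Eval R
  open import Relation.Binary.Reasoning.Setoid setoid
  open import Algebra.Properties.Semiring.Exp semiring using (^-assocʳ)
  open CommutativeSemigroupProperties +-commutativeSemigroup using (interchange)

  infixr 8 [_]·_

  [_]·_ : Bool → R₀ → R₀
  [ true  ]· v = v
  [ false ]· v = 0#

  []·-cong : ∀ β {v w} → v ≈ w → [ β ]· v ≈ [ β ]· w
  []·-cong true  v≈w = v≈w
  []·-cong false v≈w = refl

  []·-∧ : ∀ β γ v → [ β ∧ γ ]· v ≡ [ β ]· [ γ ]· v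
  []·-∧ true  γ v = ≡.refl
  []·-∧ false γ v = ≡.refl

  Σ-cong : ∀ {A : Set} {f g : A → R₀} → (∀ a → f a ≈ g a) → ∀ xs → Σ f xs ≈ Σ g xs
  Σ-cong f≈g []       = refl
  Σ-cong f≈g (x ∷ xs) = +-cong (f≈g x) (Σ-cong f≈g xs)

  Σ-zero : ∀ {A : Set} (xs : List A) → Σ (λ _ → 0#) xs ≈ 0#
  Σ-zero []       = refl
  Σ-zero (x ∷ xs) = trans (+-identityˡ _) (Σ-zero xs)

  Σ-+ : ∀ {A : Set} (f g : A → R₀) xs → Σ (λ a → f a + g a) xs ≈ Σ f xs + Σ g xs
  Σ-+ f g []       = sym (+-identityˡ 0#)
  Σ-+ f g (x ∷ xs) = trans (+-congˡ (Σ-+ f g xs)) (interchange (f x) (g x) (Σ f xs) (Σ g xs))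

  Σ-++ : ∀ {A : Set} (f : A → R₀) xs ys → Σ f (xs ++ ys) ≈ Σ f xs + Σ f ys
  Σ-++ f []       ys = sym (+-identityˡ _)
  Σ-++ f (x ∷ xs) ys = trans (+-congˡ (Σ-++ f xs ys)) (sym (+-assoc _ _ _))

  Σ-map : ∀ {A B : Set} (f : B → R₀) (g : A → B) xs → Σ f (map g xs) ≡ Σ (f ∘ g) xs
  Σ-map f g []       = ≡.refl
  Σ-map f g (x ∷ xs) = ≡.cong (f (g x) +_) (Σ-map f g xs)

  Σ-const : ∀ {A : Set} v (xs : List A) → Σ (λ _ → v) xs ≈ length xs · v
  Σ-const v []       = refl
  Σ-const v (x ∷ xs) = +-congˡ (Σ-const v xs)

  Σ-cartesianProduct : ∀ {A B : Set} (f : A × B → R₀) xs ys →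
                       Σ f (cartesianProduct xs ys) ≈ Σ (λ x → Σ (λ y → f (x , y)) ys) xs
  Σ-cartesianProduct f []       ys = refl
  Σ-cartesianProduct f (x ∷ xs) ys =
    trans (Σ-++ f (map (x ,_) ys) (cartesianProduct xs ys))
          (+-cong (reflexive (Σ-map f (x ,_) ys)) (Σ-cartesianProduct f xs ys))

  Σ-comm : ∀ {A B : Set} (f : A → B → R₀) xs ys →
           Σ (λ x → Σ (f x) ys) xs ≈ Σ (λ y → Σ (λ x → f x y) xs) ys
  Σ-comm f []       ys = sym (Σ-zero ys)
  Σ-comm f (x ∷ xs) ys = trans (+-congˡ (Σ-comm f xs ys)) (sym (Σ-+ (f x) _ ys))

  Σ-filter : ∀ {A : Set} {P : Pred A p} (P? : Decidable P) (f : A → R₀) xs →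
             Σ f (filter P? xs) ≈ Σ (λ x → [ does (P? x) ]· f x) xs
  Σ-filter P? f []       = refl
  Σ-filter P? f (x ∷ xs) with does (P? x)
  ... | true  = +-congˡ (Σ-filter P? f xs)
  ... | false = trans (Σ-filter P? f xs) (sym (+-identityˡ _))

  Σ-[]· : ∀ {A : Set} β (f : A → R₀) xs → Σ (λ x → [ β ]· f x) xs ≈ [ β ]· Σ f xs
  Σ-[]· true  f xs = refl
  Σ-[]· false f xs = Σ-zero xs

  length-filter-· : ∀ {A : Set} {P : Pred A p} (P? : Decidable P) xs v →
                    length (filter P? xs) · v ≈ Σ (λ x → [ does (P? x) ]· v) xs
  length-filter-· P? xs v = trans (sym (Σ-const v (filter P? xs))) (Σ-filter P? (λ _ → v) xs)

  Σ-applyUpTo-suc : ∀ (f : ℕ → R₀) N → Σ f (applyUpTo suc N) ≡ Σ (f ∘ suc) (upTo N)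
  Σ-applyUpTo-suc f N = ≡.trans (≡.cong (Σ f) (≡.sym (map-upTo suc N))) (Σ-map f suc (upTo N))

  Σ-upTo-δ : ∀ (h : ℕ → R₀) {e N} → e ℕ.< N → Σ (λ i → [ does (e ℕ.≟ i) ]· h i) (upTo N) ≈ h e
  Σ-upTo-δ h {zero} {suc N} _ = begin
    h 0 + Σ (λ i → [ does (0 ℕ.≟ i) ]· h i) (applyUpTo suc N)
      ≡⟨ ≡.cong (h 0 +_) (Σ-applyUpTo-suc _ N) ⟩
    h 0 + Σ (λ _ → 0#) (upTo N)
      ≈⟨ +-congˡ (Σ-zero (upTo N)) ⟩
    h 0 + 0#
      ≈⟨ +-identityʳ (h 0) ⟩
    h 0 ∎
  -- does (suc e ≟ suc i) reduces to does (e ≟ i): ℕ._≟_ is computed by _≡ᵇ_.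
  Σ-upTo-δ h {suc e} {suc N} (s≤s e<N) = begin
    0# + Σ (λ i → [ does (suc e ℕ.≟ i) ]· h i) (applyUpTo suc N)
      ≡⟨ ≡.cong (0# +_) (Σ-applyUpTo-suc _ N) ⟩
    0# + Σ (λ i → [ does (e ℕ.≟ i) ]· h (suc i)) (upTo N)
      ≈⟨ +-identityˡ _ ⟩
    Σ (λ i → [ does (e ℕ.≟ i) ]· h (suc i)) (upTo N)
      ≈⟨ Σ-upTo-δ (h ∘ suc) e<N ⟩
    h (suc e) ∎

  Σ³-upTo-δ : ∀ (f : ℕ → ℕ → ℕ → R₀) {e₁ e₂ e₃ N} → e₁ ℕ.< N → e₂ ℕ.< N → e₃ ℕ.< N →
    Σ (λ i → Σ (λ j → Σ (λ k →
        [ does (≡-dec ℕ._≟_ (≡-dec ℕ._≟_ ℕ._≟_) (e₁ , e₂ , e₃) (i , j , k)) ]· f i j k)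
      (upTo N)) (upTo N)) (upTo N)
    ≈ f e₁ e₂ e₃
  Σ³-upTo-δ f {e₁} {e₂} {e₃} {N} e₁<N e₂<N e₃<N = begin
    Σ (λ i → Σ (λ j → Σ (λ k →
        [ does (≡-dec ℕ._≟_ (≡-dec ℕ._≟_ ℕ._≟_) (e₁ , e₂ , e₃) (i , j , k)) ]· f i j k) rng) rng) rng
      ≈⟨ Σ-cong (λ i → Σ-cong (λ j → Σ-cong (λ k → reflexive (split i j k)) rng) rng) rng ⟩
    Σ (λ i → Σ (λ j → Σ (λ k → [ δ₁ i ]· [ δ₂ j ]· [ δ₃ k ]· f i j k) rng) rng) rng
      ≈⟨ Σ-cong (λ i → trans (Σ-cong (λ j → Σ-[]· (δ₁ i) _ rng) rng) (Σ-[]· (δ₁ i) _ rng)) rng ⟩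
    Σ (λ i → [ δ₁ i ]· Σ (λ j → Σ (λ k → [ δ₂ j ]· [ δ₃ k ]· f i j k) rng) rng) rng
      ≈⟨ Σ-upTo-δ _ e₁<N ⟩
    Σ (λ j → Σ (λ k → [ δ₂ j ]· [ δ₃ k ]· f e₁ j k) rng) rng
      ≈⟨ Σ-cong (λ j → Σ-[]· (δ₂ j) _ rng) rng ⟩
    Σ (λ j → [ δ₂ j ]· Σ (λ k → [ δ₃ k ]· f e₁ j k) rng) rng
      ≈⟨ Σ-upTo-δ _ e₂<N ⟩
    Σ (λ k → [ δ₃ k ]· f e₁ e₂ k) rng
      ≈⟨ Σ-upTo-δ _ e₃<N ⟩
    f e₁ e₂ e₃ ∎
    where
    rng = upTo N
    δ₁ δ₂ δ₃ : ℕ → Bool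
    δ₁ i = does (e₁ ℕ.≟ i)
    δ₂ j = does (e₂ ℕ.≟ j)
    δ₃ k = does (e₃ ℕ.≟ k)
    split : ∀ i j k → [ does (≡-dec ℕ._≟_ (≡-dec ℕ._≟_ ℕ._≟_) (e₁ , e₂ , e₃) (i , j , k)) ]· f i j k
                      ≡ [ δ₁ i ]· [ δ₂ j ]· [ δ₃ k ]· f i j k
    split i j k = ≡.trans (≡.cong ([_]· f i j k) (does-≟³ e₁ e₂ e₃ i j k))
                  (≡.trans ([]·-∧ (δ₁ i) _ _) (≡.cong ([ δ₁ i ]·_) ([]·-∧ (δ₂ j) _ _)))

  weight : (S : FinPoset) → R₀ → R₀ → R₀ → Carrier S → Carrier S → R₀
  weight S x y z u v = x ^ ∣Λ∣ S v * y ^ ∣V∣ S u * z ^ ∣[_,_]∣ S u v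

  Σ-comparablePairs : (S : FinPoset) (F : Carrier S × Carrier S → R₀) →
    Σ F (comparablePairs S) ≈ Σ (λ u → Σ (λ v → [ does (_≤?_ S u v) ]· F (u , v)) (elems S)) (elems S)
  Σ-comparablePairs S F =
    trans (Σ-filter (λ uv → _≤?_ S (proj₁ uv) (proj₂ uv)) F (cartesianProduct (elems S) (elems S)))
          (Σ-cartesianProduct _ (elems S) (elems S))

  Σ-comparablePairs≈ΣCoeff : (S : FinPoset) (f : ℕ → ℕ → ℕ → R₀) →
    Σ (λ uv → f (∣Λ∣ S (proj₂ uv)) (∣V∣ S (proj₁ uv)) (∣[_,_]∣ S (proj₁ uv) (proj₂ uv))) (comparablePairs S)
    ≈ ΣCoeff S f
  Σ-comparablePairs≈ΣCoeff S f = sym (begin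
    Σ (λ i → Σ (λ j → Σ (λ k → coeff S i j k · f i j k) rng) rng) rng
      ≈⟨ Σ-cong (λ i → Σ-cong (λ j → Σ-cong (λ k →
           length-filter-· (hasExps i j k) pairs (f i j k)) rng) rng) rng ⟩
    Σ (λ i → Σ (λ j → Σ (λ k → Σ (term i j k) pairs) rng) rng) rng
      ≈⟨ Σ-cong (λ i → Σ-cong (λ j → Σ-comm (term i j) rng pairs) rng) rng ⟩
    Σ (λ i → Σ (λ j → Σ (λ uv → Σ (λ k → term i j k uv) rng) pairs) rng) rng
      ≈⟨ Σ-cong (λ i → Σ-comm _ rng pairs) rng ⟩
    Σ (λ i → Σ (λ uv → Σ (λ j → Σ (λ k → term i j k uv) rng) rng) pairs) rng
      ≈⟨ Σ-comm _ rng pairs ⟩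
    Σ (λ uv → Σ (λ i → Σ (λ j → Σ (λ k → term i j k uv) rng) rng) rng) pairs
      ≈⟨ Σ-cong (λ uv → Σ³-upTo-δ f (bound _) (bound _) (bound _)) pairs ⟩
    Σ (λ uv → f (∣Λ∣ S (proj₂ uv)) (∣V∣ S (proj₁ uv)) (∣[_,_]∣ S (proj₁ uv) (proj₂ uv))) pairs ∎)
    where
    rng   = upTo (suc (length (elems S)))
    pairs = comparablePairs S
    hasExps : ∀ i j k → Decidable (λ uv → exps S uv ≡ (i , j , k))
    hasExps i j k uv = ≡-dec ℕ._≟_ (≡-dec ℕ._≟_ ℕ._≟_) (exps S uv) (i , j , k)
    term : ℕ → ℕ → ℕ → Carrier S × Carrier S → R₀
    term i j k uv = [ does (hasExps i j k uv) ]· f i j k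
    bound : ∀ {p} {Pr : Pred (Carrier S) p} (Pr? : Decidable Pr) →
            length (filter Pr? (elems S)) ℕ.< suc (length (elems S))
    bound Pr? = s≤s (length-filter Pr? (elems S))

  Σ-comparablePairs-×ᴾ : (P Q : FinPoset) (F : Carrier (P ×ᴾ Q) × Carrier (P ×ᴾ Q) → R₀) →
    Σ F (comparablePairs (P ×ᴾ Q))
    ≈ Σ (λ ac → Σ (λ bd → F ((proj₁ ac , proj₁ bd) , (proj₂ ac , proj₂ bd)))
                  (comparablePairs Q))
        (comparablePairs P)
  Σ-comparablePairs-×ᴾ P Q F = begin
    Σ F (comparablePairs (P ×ᴾ Q))
      ≈⟨ Σ-comparablePairs (P ×ᴾ Q) F ⟩
    Σ (λ ab → Σ (λ cd → [ does (_≤?_ (P ×ᴾ Q) ab cd) ]· F (ab , cd)) ePQ) ePQ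
      ≈⟨ Σ-cartesianProduct _ eP eQ ⟩
    Σ (λ a → Σ (λ b → Σ (λ cd → [ ≤P a (proj₁ cd) ∧ ≤Q b (proj₂ cd) ]· G a b (proj₁ cd) (proj₂ cd))
                        ePQ) eQ) eP
      ≈⟨ Σ-cong (λ a → Σ-cong (λ b → Σ-cartesianProduct _ eP eQ) eQ) eP ⟩
    Σ (λ a → Σ (λ b → Σ (λ c → Σ (λ d → [ ≤P a c ∧ ≤Q b d ]· G a b c d) eQ) eP) eQ) eP
      ≈⟨ Σ-cong (λ a → Σ-comm _ eQ eP) eP ⟩
    Σ (λ a → Σ (λ c → Σ (λ b → Σ (λ d → [ ≤P a c ∧ ≤Q b d ]· G a b c d) eQ) eQ) eP) eP
      ≈⟨ Σ-cong (λ a → Σ-cong (λ c → pull-out a c) eP) eP ⟩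
    Σ (λ a → Σ (λ c → [ ≤P a c ]· Σ (λ b → Σ (λ d → [ ≤Q b d ]· G a b c d) eQ) eQ) eP) eP
      ≈⟨ Σ-cong (λ a → Σ-cong (λ c → []·-cong (≤P a c) (sym (Σ-comparablePairs Q _))) eP) eP ⟩
    Σ (λ a → Σ (λ c → [ ≤P a c ]· Σ (λ bd → G a (proj₁ bd) c (proj₂ bd)) (comparablePairs Q)) eP) eP
      ≈⟨ sym (Σ-comparablePairs P _) ⟩
    Σ (λ ac → Σ (λ bd → G (proj₁ ac) (proj₁ bd) (proj₂ ac) (proj₂ bd)) (comparablePairs Q))
      (comparablePairs P) ∎
    where
    eP  = elems P
    eQ  = elems Q
    ePQ = elems (P ×ᴾ Q)
    G : Carrier P → Carrier Q → Carrier P → Carrier Q → R₀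
    G a b c d = F ((a , b) , (c , d))
    ≤P : Carrier P → Carrier P → Bool
    ≤P a c = does (_≤?_ P a c)
    ≤Q : Carrier Q → Carrier Q → Bool
    ≤Q b d = does (_≤?_ Q b d)
    pull-out : ∀ a c → Σ (λ b → Σ (λ d → [ ≤P a c ∧ ≤Q b d ]· G a b c d) eQ) eQ
                       ≈ [ ≤P a c ]· Σ (λ b → Σ (λ d → [ ≤Q b d ]· G a b c d) eQ) eQ
    pull-out a c =
      trans (Σ-cong (λ b → trans (Σ-cong (λ d → reflexive ([]·-∧ (≤P a c) (≤Q b d) _)) eQ)
                                 (Σ-[]· (≤P a c) _ eQ)) eQ)
            (Σ-[]· (≤P a c) _ eQ)

  ^-of-* : ∀ X {k} m n → k ≡ m ℕ.* n → X ^ k ≈ (X ^ m) ^ n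
  ^-of-* X m n k≡m*n = trans (reflexive (≡.cong (X ^_) k≡m*n)) (sym (^-assocʳ X m n))

  module _ (P Q : FinPoset) (x y z : R₀) where

    private
      W : Carrier P × Carrier P → Carrier Q × Carrier Q → R₀
      W ac bd = weight (P ×ᴾ Q) x y z (proj₁ ac , proj₁ bd) (proj₂ ac , proj₂ bd)

    weight-×ᴾ≈weightʳ : ∀ a b c d → weight (P ×ᴾ Q) x y z (a , b) (c , d)
                        ≈ weight Q (x ^ ∣Λ∣ P c) (y ^ ∣V∣ P a) (z ^ ∣[_,_]∣ P a c) b d
    weight-×ᴾ≈weightʳ a b c d =
      *-cong (*-cong (^-of-* x (∣Λ∣ P c) (∣Λ∣ Q d) (∣Λ∣-×ᴾ P Q c d))
                     (^-of-* y (∣V∣ P a) (∣V∣ Q b) (∣V∣-×ᴾ P Q a b)))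
             (^-of-* z (∣[_,_]∣ P a c) (∣[_,_]∣ Q b d) (∣[]∣-×ᴾ P Q a b c d))

    weight-×ᴾ≈weightˡ : ∀ a b c d → weight (P ×ᴾ Q) x y z (a , b) (c , d)
                        ≈ weight P (x ^ ∣Λ∣ Q d) (y ^ ∣V∣ Q b) (z ^ ∣[_,_]∣ Q b d) a c
    weight-×ᴾ≈weightˡ a b c d =
      *-cong (*-cong (^-of-* x (∣Λ∣ Q d) (∣Λ∣ P c) (≡.trans (∣Λ∣-×ᴾ P Q c d) (ℕₚ.*-comm (∣Λ∣ P c) _)))
                     (^-of-* y (∣V∣ Q b) (∣V∣ P a) (≡.trans (∣V∣-×ᴾ P Q a b) (ℕₚ.*-comm (∣V∣ P a) _))))
             (^-of-* z (∣[_,_]∣ Q b d) (∣[_,_]∣ P a c)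
                     (≡.trans (∣[]∣-×ᴾ P Q a b c d) (ℕₚ.*-comm (∣[_,_]∣ P a c) _)))

    φ-×ᴾ≈ΣCoeffʳ : φ (P ×ᴾ Q) x y z ≈ ΣCoeff Q (λ i j k → φ P (x ^ i) (y ^ j) (z ^ k))
    φ-×ᴾ≈ΣCoeffʳ = begin
      φ (P ×ᴾ Q) x y z
        ≈⟨ Σ-comparablePairs-×ᴾ P Q _ ⟩
      Σ (λ ac → Σ (λ bd → W ac bd) (comparablePairs Q)) (comparablePairs P)
        ≈⟨ Σ-comm W (comparablePairs P) (comparablePairs Q) ⟩
      Σ (λ bd → Σ (λ ac → W ac bd) (comparablePairs P)) (comparablePairs Q)
        ≈⟨ Σ-cong (λ bd → Σ-cong (λ ac → weight-×ᴾ≈weightˡ _ _ _ _) (comparablePairs P))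
                  (comparablePairs Q) ⟩
      Σ (λ bd → φ P (x ^ ∣Λ∣ Q (proj₂ bd)) (y ^ ∣V∣ Q (proj₁ bd)) (z ^ ∣[_,_]∣ Q (proj₁ bd) (proj₂ bd)))
        (comparablePairs Q)
        ≈⟨ Σ-comparablePairs≈ΣCoeff Q _ ⟩
      ΣCoeff Q (λ i j k → φ P (x ^ i) (y ^ j) (z ^ k)) ∎

    φ-×ᴾ≈ΣCoeffˡ : φ (P ×ᴾ Q) x y z ≈ ΣCoeff P (λ i j k → φ Q (x ^ i) (y ^ j) (z ^ k))
    φ-×ᴾ≈ΣCoeffˡ = begin
      φ (P ×ᴾ Q) x y z
        ≈⟨ Σ-comparablePairs-×ᴾ P Q _ ⟩
      Σ (λ ac → Σ (λ bd → W ac bd) (comparablePairs Q)) (comparablePairs P)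
        ≈⟨ Σ-cong (λ ac → Σ-cong (λ bd → weight-×ᴾ≈weightʳ _ _ _ _) (comparablePairs Q))
                  (comparablePairs P) ⟩
      Σ (λ ac → φ Q (x ^ ∣Λ∣ P (proj₂ ac)) (y ^ ∣V∣ P (proj₁ ac)) (z ^ ∣[_,_]∣ P (proj₁ ac) (proj₂ ac)))
        (comparablePairs P)
        ≈⟨ Σ-comparablePairs≈ΣCoeff P _ ⟩
      ΣCoeff P (λ i j k → φ Q (x ^ i) (y ^ j) (z ^ k)) ∎

mainTheorem3 : {c ℓ : Level} (R : CommutativeSemiring c ℓ) (P Q : FinPoset)
               (x y z : CommutativeSemiring.Carrier R) →
               let open CommutativeSemiring R
                   open Eval R
               in (φ (P ×ᴾ Q) x y z ≈ ΣCoeff Q (λ i j k → φ P (x ^ i) (y ^ j) (z ^ k)))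
                  × (φ (P ×ᴾ Q) x y z ≈ ΣCoeff P (λ i j k → φ Q (x ^ i) (y ^ j) (z ^ k)))
mainTheorem3 R P Q x y z = φ-×ᴾ≈ΣCoeffʳ R P Q x y z , φ-×ᴾ≈ΣCoeffˡ R P Q x y z
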